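{- Let $m$ be a positive even integer and $t$ a positive integer with $t<\frac{m}{2}$. Let $A, B\subseteq \mathbb{Z}_{m}$ with $A\cup B=\mathbb{Z}_{m}$ and $A\cap B=\{\overline{r_{1}}, \overline{r_{2}}, \ldots, \overline{r_{2t}}\}$, where $r_1,\dots,r_{2t}$ are integers whose residue classes are pairwise distinct. If $R_{A}(\overline{n})=R_{B}(\overline{n})$ for all $\overline{n}\in \mathbb{Z}_{m}$, then for every integer $n$, $$\sum_{i=1}^{2t}\chi_{A}(n-r_{i})=t+\frac{1}{2}R_{\{\overline{r_{1}}, \overline{r_{2}}, \ldots, \overline{r_{2t}}\}}(\overline{n}).$$
   Context: $\mathbb{Z}_m$ denotes the set (group) of residue classes modulo $m$, and $\overline{n}$ is the residue class of the integer $n$. For $S\subseteq\mathbb{Z}_m$ and $\overline{n}\in\mathbb{Z}_m$, $R_S(\overline{n})$ is the number of ordered pairs $(\overline{a},\overline{a'})\in S\times S$ with $\overline{a}+\overline{a'}=\overline{n}$. For $A\subseteq\mathbb{Z}_m$ and an integer $n$, $\chi_A(n)=1$ if $\overline{n}\in A$ and $\chi_A(n)=0$ otherwise. -}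

module Defs where

open import Data.Nat using (ℕ; suc; _+_; _%_)
open import Data.Integer using (ℤ; _%ℕ_)
open import Data.Fin using (Fin; toℕ; fromℕ<)
open import Data.Fin.Subset using (Subset; _∈_)
open import Data.Fin.Subset.Properties using (_∈?_)
open import Data.Nat.DivMod using (m%n<n)
open import Data.Integer.DivMod using (n%ℕd<d)
open import Data.Fin.Properties using (_≟_)
open import Data.Product using (_×_; _,_)
open import Data.List using (List; length; filter; cartesianProduct; allFin)
open import Relation.Nullary using (Dec; yes; no; _×-dec_; does)
open import Data.Vec using (tabulate)
open import Data.Fin.Properties using (any?)

-- ℤ_m for m = suc k is modelled as Fin (suc k) (residues 0..m-1).

res : (k : ℕ) → ℤ → Fin (suc k)
res k n = fromℕ< (n%ℕd<d n (suc k))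

_⊕_ : {k : ℕ} → Fin (suc k) → Fin (suc k) → Fin (suc k)
_⊕_ {k} a b = fromℕ< (m%n<n (toℕ a + toℕ b) (suc k))

R : {k : ℕ} → Subset (suc k) → Fin (suc k) → ℕ
R {k} S n = length (filter P? (cartesianProduct (allFin (suc k)) (allFin (suc k))))
  where
  P? : (p : Fin (suc k) × Fin (suc k)) → Dec _
  P? (a , a') = (a ∈? S) ×-dec ((a' ∈? S) ×-dec ((a ⊕ a') ≟ n))

χ : {k : ℕ} → Subset (suc k) → ℤ → ℕ
χ {k} A n with res k n ∈? A
... | yes _ = 1
... | no _ = 0

resSet : (k : ℕ) {j : ℕ} → (Fin j → ℤ) → Subset (suc k)
resSet k {j} r = tabulate (λ x → does (any? (λ i → x ≟ res k (r i))))

module Submission where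

-- Write X, Y, Z : ℤ_m → ℕ for the indicator functions
-- of A, B and C = A ∩ B, and (U ⋆ V)(n) = Σ_{a + b = n} U(a) V(b) for the
-- additive convolution on ℤ_m, so that R_S = 1_S ⋆ 1_S.  Since A ∪ B = ℤ_m
-- we have X + Y = 1 + Z pointwise, hence for every W
--     W ⋆ X + W ⋆ Y = W ⋆ (1 + Z) = |W| + W ⋆ Z.                     (*)
-- Summing R_A = R_B over ℤ_m gives |A|² = |B|², so |A| = |B|.  Then (*) with
-- W = X and W = Y, together with X ⋆ X = Y ⋆ Y and commutativity, gives
-- X ⋆ Z = Y ⋆ Z, and (*) with W = Z yields
--     2 (X ⋆ Z)(n) = X ⋆ Z + Y ⋆ Z = |C| + (Z ⋆ Z)(n) = 2t + R_C(n).
-- Finally (X ⋆ Z)(n) = Σ_i X(n - r_i) = Σ_i χ_A(n - r_i) because Z is the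
-- indicator of the injective image of i ↦ r_i.

open import Defs
open import Data.Nat using (ℕ; suc; _+_; _*_; _<_)
open import Data.Integer using (ℤ; _-_)
open import Data.Fin using (Fin)
open import Data.Fin.Subset using (Subset; _∪_; _∩_; ⊤)
open import Data.List using (map; allFin)
open import Data.Nat.ListAction using (sum)
open import Function.Definitions using (Injective)
open import Relation.Binary.PropositionalEquality using (_≡_)

open import Data.Nat using (zero; _≤_; _⊔_; _%_)
open import Data.Nat.Properties
  using ( +-*-semiring; +-identityʳ; *-identityˡ; *-identityʳ; *-comm; *-assoc
        ; *-distribˡ-+; *-distribʳ-+; +-cancelˡ-≡; +-comm; ≤-<-trans; ⊔-lub
        ; <-cmp; <⇒≢; *-mono-< )
open import Data.Nat.DivMod using (m<n⇒m%n≡m)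
open import Data.Nat.Divisibility using (n∣m⇒m%n≡0)
open import Data.Integer as ℤ using (+_; ∣_∣; -_)
open import Data.Integer.Properties
  using ( +-injective; pos-+; i-j≡0⇒i≡j; ∣i∣≡0⇒i≡0; [+m]-[+n]≡m⊖n
        ; ∣m⊝n∣≤m⊔n; +-minus-telescope )
open import Data.Integer.DivMod using (_%ℕ_; _/ℕ_; a≡a%ℕn+[a/ℕn]*n)
open import Data.Integer.Divisibility.Signed
  using (_∣_; divides; ∣m∣n⇒∣m+n; ∣m⇒∣-m; ∣⇒∣ᵤ)
open import Data.Integer.Solver using (module +-*-Solver)
open import Data.Fin using (zero; suc; toℕ)
open import Data.Fin.Properties
  using (_≟_; any?; suc-injective; toℕ-fromℕ<; toℕ-injective; toℕ<n)
open import Data.Fin.Subset using (_∈_)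
open import Data.Fin.Subset.Properties using (_∈?_; ∈⊤; x∈p∪q⁻; x∈p∩q⁺; x∈p∩q⁻)
open import Data.Vec.Properties using ([]=⇒lookup; lookup⇒[]=; lookup∘tabulate)
open import Data.List as List using (List; []; _∷_; length; filter; cartesianProduct)
open import Data.List.Properties using (map-tabulate; map-++; map-∘)
open import Data.Nat.ListAction.Properties using (sum-++)
open import Data.Bool using (Bool; true; if_then_else_)
open import Data.Product using (∃; _×_; _,_; proj₁; proj₂)
open import Data.Sum using (_⊎_; [_,_])
open import Data.Empty using (⊥-elim)
open import Function using (_∘_; id; _⇔_; mk⇔; Equivalence)
open import Relation.Nullary using (Dec; yes; no; ¬_; _×-dec_; _⊎-dec_; does; contradiction)
open import Relation.Nullary.Decidable using (dec-true)
open import Relation.Binary.Definitions using (tri<; tri≈; tri>)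
open import Relation.Binary.PropositionalEquality
  using (refl; sym; trans; cong; cong₂; subst; _≗_; module ≡-Reasoning)
open import Algebra.Properties.Semiring.Sum +-*-semiring
  using (∑-comm; ∑-distrib-+; sum-cong-≗; sum-replicate-zero
        ; *-distribˡ-sum; *-distribʳ-sum)
  renaming (sum to ∑)

open Equivalence using (to; from)

-- Iverson brackets: ⟦ P? ⟧ is 1 if the decided proposition holds and 0 otherwise.
-- It only inspects the boolean 'does P?', so it computes on composite
-- decisions such as P? ×-dec Q?.
⟦_⟧ : ∀ {p} {P : Set p} → Dec P → ℕ
⟦ P? ⟧ = if does P? then 1 else 0

⟦⟧-⇔ : ∀ {p q} {P : Set p} {Q : Set q} (P? : Dec P) (Q? : Dec Q) →
       P ⇔ Q → ⟦ P? ⟧ ≡ ⟦ Q? ⟧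
⟦⟧-⇔ (yes _) (yes _) _ = refl
⟦⟧-⇔ (no _) (no _) _ = refl
⟦⟧-⇔ (yes p) (no ¬q) P⇔Q = contradiction (to P⇔Q p) ¬q
⟦⟧-⇔ (no ¬p) (yes q) P⇔Q = contradiction (from P⇔Q q) ¬p

⟦⟧-× : ∀ {p q} {P : Set p} {Q : Set q} (P? : Dec P) (Q? : Dec Q) →
       ⟦ P? ×-dec Q? ⟧ ≡ ⟦ P? ⟧ * ⟦ Q? ⟧
⟦⟧-× (yes _) Q? = sym (+-identityʳ ⟦ Q? ⟧)
⟦⟧-× (no _) Q? = refl

⟦⟧-⊎ : ∀ {p q} {P : Set p} {Q : Set q} (P? : Dec P) (Q? : Dec Q) →
       ¬ (P × Q) → ⟦ P? ⊎-dec Q? ⟧ ≡ ⟦ P? ⟧ + ⟦ Q? ⟧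
⟦⟧-⊎ (yes p) (yes q) disjoint = contradiction (p , q) disjoint
⟦⟧-⊎ (yes _) (no _) _ = refl
⟦⟧-⊎ (no _) Q? _ = refl

⟦⟧-cover : ∀ {p q r} {P : Set p} {Q : Set q} {R : Set r}
           (P? : Dec P) (Q? : Dec Q) (R? : Dec R) →
           P ⊎ Q → (P × Q) ⇔ R → ⟦ P? ⟧ + ⟦ Q? ⟧ ≡ 1 + ⟦ R? ⟧
⟦⟧-cover (yes _) (yes _) (yes _) _ _ = refl
⟦⟧-cover (yes p) (yes q) (no ¬r) _ P×Q⇔R = contradiction (to P×Q⇔R (p , q)) ¬r
⟦⟧-cover (yes _) (no ¬q) (yes r) _ P×Q⇔R = contradiction (proj₂ (from P×Q⇔R r)) ¬q
⟦⟧-cover (yes _) (no _) (no _) _ _ = refl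
⟦⟧-cover (no ¬p) Q? (yes r) _ P×Q⇔R = contradiction (proj₁ (from P×Q⇔R r)) ¬p
⟦⟧-cover (no _) (yes _) (no _) _ _ = refl
⟦⟧-cover (no ¬p) (no ¬q) (no _) P⊎Q _ = ⊥-elim ([ ¬p , ¬q ] P⊎Q)

∑-syntax : ∀ n → (Fin n → ℕ) → ℕ
∑-syntax _ f = ∑ f

infix 5 ∑-syntax
syntax ∑-syntax n (λ i → x) = ∑[ i < n ] x

∑-sift : ∀ {n} (d : Fin n) (f : Fin n → ℕ) →
         ∑[ i < n ] ⟦ i ≟ d ⟧ * f i ≡ f d
∑-sift {suc n} zero f =
  trans (cong₂ _+_ (+-identityʳ (f zero)) (sum-replicate-zero n)) (+-identityʳ (f zero))
∑-sift {suc n} (suc d) f = ∑-sift d (f ∘ suc)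

∑-point : ∀ {n} (d : Fin n) → ∑[ i < n ] ⟦ d ≟ i ⟧ ≡ 1
∑-point {n} d = begin
  ∑[ i < n ] ⟦ d ≟ i ⟧
    ≡⟨ sum-cong-≗ (λ i → trans (⟦⟧-⇔ (d ≟ i) (i ≟ d) (mk⇔ sym sym))
                               (sym (*-identityʳ ⟦ i ≟ d ⟧))) ⟩
  ∑[ i < n ] ⟦ i ≟ d ⟧ * 1
    ≡⟨ ∑-sift d (λ _ → 1) ⟩
  1 ∎
  where open ≡-Reasoning

∑-one : ∀ n → ∑[ i < n ] 1 ≡ n
∑-one zero = refl
∑-one (suc n) = cong suc (∑-one n)

∑-product : ∀ {n} (f g : Fin n → ℕ) →
            ∑[ a < n ] ∑[ b < n ] f a * g b ≡ (∑[ a < n ] f a) * (∑[ b < n ] g b)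
∑-product {n} f g = begin
  ∑[ a < n ] ∑[ b < n ] f a * g b   ≡⟨ sum-cong-≗ (λ a → sym (*-distribˡ-sum (f a) g)) ⟩
  ∑[ a < n ] f a * (∑[ b < n ] g b) ≡⟨ sym (*-distribʳ-sum (∑[ b < n ] g b) f) ⟩
  (∑[ a < n ] f a) * (∑[ b < n ] g b) ∎
  where open ≡-Reasoning

count-image : ∀ {j n} (g : Fin j → Fin n) → Injective _≡_ _≡_ g → ∀ b →
              ∑[ i < j ] ⟦ b ≟ g i ⟧ ≡ ⟦ any? (λ i → b ≟ g i) ⟧
count-image {zero} g inj b = refl
count-image {suc j} g inj b = begin
  ⟦ b ≟ g zero ⟧ + (∑[ i < j ] ⟦ b ≟ g (suc i) ⟧)
    ≡⟨ cong (_+_ ⟦ b ≟ g zero ⟧) (count-image (g ∘ suc) (suc-injective ∘ inj) b) ⟩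
  ⟦ b ≟ g zero ⟧ + ⟦ any? (λ i → b ≟ g (suc i)) ⟧
    ≡⟨ sym (⟦⟧-⊎ (b ≟ g zero) (any? (λ i → b ≟ g (suc i))) at-most-once) ⟩
  ⟦ any? (λ i → b ≟ g i) ⟧ ∎
  where
  open ≡-Reasoning
  at-most-once : ¬ (b ≡ g zero × ∃ λ i → b ≡ g (suc i))
  at-most-once (b≡g₀ , i , b≡gᵢ) with inj (trans (sym b≡g₀) b≡gᵢ)
  ... | ()

∑-image : ∀ {j n} (g : Fin j → Fin n) → Injective _≡_ _≡_ g → (f : Fin n → ℕ) →
          ∑[ b < n ] ⟦ any? (λ i → b ≟ g i) ⟧ * f b ≡ ∑[ i < j ] f (g i)
∑-image {j} {n} g inj f = begin
  ∑[ b < n ] ⟦ any? (λ i → b ≟ g i) ⟧ * f b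
    ≡⟨ sum-cong-≗ (λ b → cong (_* f b) (sym (count-image g inj b))) ⟩
  ∑[ b < n ] (∑[ i < j ] ⟦ b ≟ g i ⟧) * f b
    ≡⟨ sum-cong-≗ (λ b → *-distribʳ-sum (f b) (λ i → ⟦ b ≟ g i ⟧)) ⟩
  ∑[ b < n ] ∑[ i < j ] ⟦ b ≟ g i ⟧ * f b
    ≡⟨ ∑-comm (λ b i → ⟦ b ≟ g i ⟧ * f b) ⟩
  ∑[ i < j ] ∑[ b < n ] ⟦ b ≟ g i ⟧ * f b
    ≡⟨ sum-cong-≗ (λ i → ∑-sift (g i) f) ⟩
  ∑[ i < j ] f (g i) ∎
  where open ≡-Reasoning

∑-allFin : ∀ n (f : Fin n → ℕ) → sum (map f (allFin n)) ≡ ∑[ i < n ] f i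
∑-allFin n f = trans (cong sum (map-tabulate id f)) (∑-tabulate f)
  where
  ∑-tabulate : ∀ {n} (h : Fin n → ℕ) → sum (List.tabulate h) ≡ ∑[ i < n ] h i
  ∑-tabulate {zero} h = refl
  ∑-tabulate {suc n} h = cong (_+_ (h zero)) (∑-tabulate (h ∘ suc))

length-filter : ∀ {a p} {A : Set a} {P : A → Set p} (P? : ∀ x → Dec (P x)) (xs : List A) →
                length (filter P? xs) ≡ sum (map (λ x → ⟦ P? x ⟧) xs)
length-filter P? [] = refl
length-filter P? (x ∷ xs) with P? x
... | yes _ = cong suc (length-filter P? xs)
... | no _ = length-filter P? xs

sum-cartesianProduct : ∀ {a b} {A : Set a} {B : Set b} (h : A × B → ℕ) xs (ys : List B) →
  sum (map h (cartesianProduct xs ys)) ≡ sum (map (λ x → sum (map (λ y → h (x , y)) ys)) xs)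
sum-cartesianProduct h [] ys = refl
sum-cartesianProduct h (x ∷ xs) ys = begin
  sum (map h (map (x ,_) ys List.++ cartesianProduct xs ys))
    ≡⟨ cong sum (map-++ h (map (x ,_) ys) _) ⟩
  sum (map h (map (x ,_) ys) List.++ map h (cartesianProduct xs ys))
    ≡⟨ sum-++ (map h (map (x ,_) ys)) _ ⟩
  sum (map h (map (x ,_) ys)) + sum (map h (cartesianProduct xs ys))
    ≡⟨ cong₂ _+_ (cong sum (sym (map-∘ ys))) (sum-cartesianProduct h xs ys) ⟩
  sum (map (λ y → h (x , y)) ys) + sum (map (λ x → sum (map (λ y → h (x , y)) ys)) xs) ∎
  where open ≡-Reasoning

count-pairs : ∀ {n p} {P : Fin n × Fin n → Set p} (P? : ∀ x → Dec (P x))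
  (F : Fin n → Fin n → ℕ) → (∀ a b → ⟦ P? (a , b) ⟧ ≡ F a b) →
  length (filter P? (cartesianProduct (allFin n) (allFin n))) ≡
    ∑[ a < n ] ∑[ b < n ] F a b
count-pairs {n} P? F bracket≡F = begin
  length (filter P? (cartesianProduct (allFin n) (allFin n)))
    ≡⟨ length-filter P? (cartesianProduct (allFin n) (allFin n)) ⟩
  sum (map (λ x → ⟦ P? x ⟧) (cartesianProduct (allFin n) (allFin n)))
    ≡⟨ sum-cartesianProduct (λ x → ⟦ P? x ⟧) (allFin n) (allFin n) ⟩
  sum (map (λ a → sum (map (λ b → ⟦ P? (a , b) ⟧) (allFin n))) (allFin n))
    ≡⟨ ∑-allFin n _ ⟩
  ∑[ a < n ] sum (map (λ b → ⟦ P? (a , b) ⟧) (allFin n))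
    ≡⟨ sum-cong-≗ (λ a → ∑-allFin n (λ b → ⟦ P? (a , b) ⟧)) ⟩
  ∑[ a < n ] ∑[ b < n ] ⟦ P? (a , b) ⟧
    ≡⟨ sum-cong-≗ (λ a → sum-cong-≗ (bracket≡F a)) ⟩
  ∑[ a < n ] ∑[ b < n ] F a b ∎
  where open ≡-Reasoning

module Residues (k : ℕ) where

  m : ℕ
  m = suc k

  -- Congruence modulo m: m divides the difference.  (A record rather than
  -- a definition, so that x and y can be inferred from a proof of x ≡ₘ y.)
  infix 4 _≡ₘ_
  record _≡ₘ_ (x y : ℤ) : Set where
    constructor congruent
    field m∣x-y : + m ∣ x - y

  private
    open +-*-Solver
    neg-minus : ∀ x y → - (x - y) ≡ y - x
    neg-minus = solve 2 (λ x y → :- (x :- y) := y :- x) refl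
    minus-+ : ∀ x x′ y y′ → (x - x′) ℤ.+ (y - y′) ≡ (x ℤ.+ y) - (x′ ℤ.+ y′)
    minus-+ = solve 4 (λ x x′ y y′ → (x :- x′) :+ (y :- y′) := (x :+ y) :- (x′ :+ y′)) refl
    plus-minus : ∀ r q → (r ℤ.+ q) - r ≡ q
    plus-minus = solve 2 (λ r q → (r :+ q) :- r := q) refl
    shift : ∀ u v w → (u ℤ.+ v) - w ≡ u - (w - v)
    shift = solve 3 (λ u v w → (u :+ v) :- w := u :- (w :- v)) refl
    minus-plus : ∀ x y → (x - y) ℤ.+ y ≡ x
    minus-plus = solve 2 (λ x y → (x :- y) :+ y := x) refl

  ≡ₘ-sym : ∀ {x y} → x ≡ₘ y → y ≡ₘ x
  ≡ₘ-sym {x} {y} (congruent p) = congruent (subst (+ m ∣_) (neg-minus x y) (∣m⇒∣-m p))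

  ≡ₘ-trans : ∀ {x y z} → x ≡ₘ y → y ≡ₘ z → x ≡ₘ z
  ≡ₘ-trans {x} {y} {z} (congruent p) (congruent q) =
    congruent (subst (+ m ∣_) (+-minus-telescope x y z) (∣m∣n⇒∣m+n p q))

  ≡ₘ-+ : ∀ {x x′ y y′} → x ≡ₘ x′ → y ≡ₘ y′ → x ℤ.+ y ≡ₘ x′ ℤ.+ y′
  ≡ₘ-+ {x} {x′} {y} {y′} (congruent p) (congruent q) =
    congruent (subst (+ m ∣_) (minus-+ x x′ y y′) (∣m∣n⇒∣m+n p q))

  ≡ₘ-shift : ∀ {u v w} → (u ℤ.+ v ≡ₘ w) ⇔ (u ≡ₘ w - v)
  ≡ₘ-shift {u} {v} {w} =
    mk⇔ (λ (congruent p) → congruent (subst (+ m ∣_) (shift u v w) p))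
        (λ (congruent p) → congruent (subst (+ m ∣_) (sym (shift u v w)) p))

  ≡ₘ-res : ∀ x → x ≡ₘ + toℕ (res k x)
  ≡ₘ-res x = congruent (divides (x /ℕ m) (begin
    x - + toℕ (res k x)                       ≡⟨ cong (λ r → x - + r) (toℕ-fromℕ< _) ⟩
    x - + (x %ℕ m)                            ≡⟨ cong (_- + (x %ℕ m)) (a≡a%ℕn+[a/ℕn]*n x m) ⟩
    (+ (x %ℕ m) ℤ.+ x /ℕ m ℤ.* + m) - + (x %ℕ m) ≡⟨ plus-minus (+ (x %ℕ m)) _ ⟩
    x /ℕ m ℤ.* + m                            ∎))
    where open ≡-Reasoning

  residue-unique : ∀ {a b} → a < m → b < m → + a ≡ₘ + b → a ≡ b
  residue-unique {a} {b} a<m b<m (congruent m∣a-b) =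
    +-injective (i-j≡0⇒i≡j (+ a) (+ b) (∣i∣≡0⇒i≡0 distance≡0))
    where
    distance<m : ∣ + a - + b ∣ < m
    distance<m = ≤-<-trans
      (subst (_≤ a ⊔ b) (cong ∣_∣ (sym ([+m]-[+n]≡m⊖n a b))) (∣m⊝n∣≤m⊔n a b))
      (⊔-lub a<m b<m)
    distance≡0 : ∣ + a - + b ∣ ≡ 0
    distance≡0 = trans (sym (m<n⇒m%n≡m distance<m)) (n∣m⇒m%n≡0 _ m (∣⇒∣ᵤ m∣a-b))

  res-≡⇔≡ₘ : ∀ {x y} → res k x ≡ res k y ⇔ x ≡ₘ y
  res-≡⇔≡ₘ {x} {y} = mk⇔
    (λ e → ≡ₘ-trans (≡ₘ-res x) (subst (λ r → + toℕ r ≡ₘ y) (sym e) (≡ₘ-sym (≡ₘ-res y))))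
    (λ p → toℕ-injective (residue-unique (toℕ<n (res k x)) (toℕ<n (res k y))
             (≡ₘ-trans (≡ₘ-sym (≡ₘ-res x)) (≡ₘ-trans p (≡ₘ-res y)))))

  res-toℕ : ∀ (a : Fin m) → res k (+ toℕ a) ≡ a
  res-toℕ a = toℕ-injective (trans (toℕ-fromℕ< _) (m<n⇒m%n≡m (toℕ<n a)))

  res-+ : ∀ x y → res k x ⊕ res k y ≡ res k (x ℤ.+ y)
  res-+ x y = trans ⊕-as-res (from res-≡⇔≡ₘ residues≡ₘsum)
    where
    rx = toℕ (res k x)
    ry = toℕ (res k y)
    ⊕-as-res : res k x ⊕ res k y ≡ res k (+ (rx + ry))
    ⊕-as-res = toℕ-injective (trans (toℕ-fromℕ< _) (sym (toℕ-fromℕ< _)))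
    residues≡ₘsum : + (rx + ry) ≡ₘ x ℤ.+ y
    residues≡ₘsum = subst (_≡ₘ x ℤ.+ y) (sym (pos-+ rx ry))
                          (≡ₘ-+ (≡ₘ-sym (≡ₘ-res x)) (≡ₘ-sym (≡ₘ-res y)))

  ⊕-comm : ∀ (a b : Fin m) → a ⊕ b ≡ b ⊕ a
  ⊕-comm a b = toℕ-injective (trans (toℕ-fromℕ< _)
                 (trans (cong (_% m) (+-comm (toℕ a) (toℕ b))) (sym (toℕ-fromℕ< _))))

  _⊖ₘ_ : Fin m → Fin m → Fin m
  a ⊖ₘ b = res k (+ toℕ a - + toℕ b)

  ⊕-⊖ₘ : ∀ {a b c} → a ⊕ b ≡ c ⇔ a ≡ c ⊖ₘ b
  ⊕-⊖ₘ {a} {b} {c} = mk⇔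
    (λ e → trans (sym (res-toℕ a))
      (from (res-≡⇔≡ₘ {A} {C - B}) (to (≡ₘ-shift {A} {B} {C})
        (to (res-≡⇔≡ₘ {A ℤ.+ B} {C}) (trans (sym lift) (trans e (sym (res-toℕ c))))))))
    (λ e → trans lift (trans
      (from (res-≡⇔≡ₘ {A ℤ.+ B} {C}) (from (≡ₘ-shift {A} {B} {C})
        (to (res-≡⇔≡ₘ {A} {C - B}) (trans (res-toℕ a) e))))
      (res-toℕ c)))
    where
    A = + toℕ a
    B = + toℕ b
    C = + toℕ c
    lift : a ⊕ b ≡ res k (A ℤ.+ B)
    lift = trans (cong₂ _⊕_ (sym (res-toℕ a)) (sym (res-toℕ b))) (res-+ A B)

  res-minus : ∀ x y → res k (x - y) ≡ res k x ⊖ₘ res k y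
  res-minus x y = to ⊕-⊖ₘ (trans (res-+ (x - y) y) (cong (res k) (minus-plus x y)))

module Convolution (k : ℕ) where

  open Residues k

  _⋆_ : (X Y : Fin m → ℕ) → Fin m → ℕ
  (X ⋆ Y) n = ∑[ a < m ] ∑[ b < m ] X a * Y b * ⟦ a ⊕ b ≟ n ⟧

  ∣_∣ₘ : (Fin m → ℕ) → ℕ
  ∣ X ∣ₘ = ∑[ a < m ] X a

  ⋆-comm : ∀ X Y n → (X ⋆ Y) n ≡ (Y ⋆ X) n
  ⋆-comm X Y n = trans (∑-comm (λ a b → X a * Y b * ⟦ a ⊕ b ≟ n ⟧))
    (sum-cong-≗ λ b → sum-cong-≗ λ a →
      cong₂ _*_ (*-comm (X a) (Y b)) (cong (λ c → ⟦ c ≟ n ⟧) (⊕-comm a b)))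

  ⋆-congʳ : ∀ X {Y V} → Y ≗ V → ∀ n → (X ⋆ Y) n ≡ (X ⋆ V) n
  ⋆-congʳ X Y≗V n = sum-cong-≗ λ a → sum-cong-≗ λ b →
    cong (λ y → X a * y * ⟦ a ⊕ b ≟ n ⟧) (Y≗V b)

  ⋆-distribʳ : ∀ X Y V n → (X ⋆ (λ b → Y b + V b)) n ≡ (X ⋆ Y) n + (X ⋆ V) n
  ⋆-distribʳ X Y V n = trans
    (sum-cong-≗ λ a → trans (sum-cong-≗ λ b → distrib (X a) (Y b) (V b) ⟦ a ⊕ b ≟ n ⟧)
                            (∑-distrib-+ (term Y a) (term V a)))
    (∑-distrib-+ (λ a → ∑[ b < m ] term Y a b) (λ a → ∑[ b < m ] term V a b))
    where
    term : (Fin m → ℕ) → Fin m → Fin m → ℕ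
    term W a b = X a * W b * ⟦ a ⊕ b ≟ n ⟧
    distrib : ∀ x y v d → x * (y + v) * d ≡ x * y * d + x * v * d
    distrib x y v d = trans (cong (_* d) (*-distribˡ-+ x y v)) (*-distribʳ-+ d (x * y) (x * v))

  ⋆-single : ∀ X Y n → (X ⋆ Y) n ≡ ∑[ b < m ] X (n ⊖ₘ b) * Y b
  ⋆-single X Y n = trans (∑-comm (λ a b → X a * Y b * ⟦ a ⊕ b ≟ n ⟧))
    (sum-cong-≗ λ b → trans (sum-cong-≗ λ a → point b a) (∑-sift (n ⊖ₘ b) (λ a → X a * Y b)))
    where
    point : ∀ b a → X a * Y b * ⟦ a ⊕ b ≟ n ⟧ ≡ ⟦ a ≟ n ⊖ₘ b ⟧ * (X a * Y b)
    point b a = trans (*-comm (X a * Y b) ⟦ a ⊕ b ≟ n ⟧)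
                      (cong (_* (X a * Y b)) (⟦⟧-⇔ (a ⊕ b ≟ n) (a ≟ n ⊖ₘ b) ⊕-⊖ₘ))

  ⋆-oneʳ : ∀ X n → (X ⋆ (λ _ → 1)) n ≡ ∣ X ∣ₘ
  ⋆-oneʳ X n = trans (⋆-comm X (λ _ → 1) n)
    (trans (⋆-single (λ _ → 1) X n) (sum-cong-≗ λ b → *-identityˡ (X b)))

  ⋆-total : ∀ X Y → ∑[ n < m ] (X ⋆ Y) n ≡ ∣ X ∣ₘ * ∣ Y ∣ₘ
  ⋆-total X Y = begin
    ∑[ n < m ] ∑[ a < m ] ∑[ b < m ] X a * Y b * ⟦ a ⊕ b ≟ n ⟧
      ≡⟨ ∑-comm (λ n a → ∑[ b < m ] X a * Y b * ⟦ a ⊕ b ≟ n ⟧) ⟩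
    ∑[ a < m ] ∑[ n < m ] ∑[ b < m ] X a * Y b * ⟦ a ⊕ b ≟ n ⟧
      ≡⟨ sum-cong-≗ (λ a → ∑-comm (λ n b → X a * Y b * ⟦ a ⊕ b ≟ n ⟧)) ⟩
    ∑[ a < m ] ∑[ b < m ] ∑[ n < m ] X a * Y b * ⟦ a ⊕ b ≟ n ⟧
      ≡⟨ sum-cong-≗ (λ a → sum-cong-≗ λ b → once (X a * Y b) (a ⊕ b)) ⟩
    ∑[ a < m ] ∑[ b < m ] X a * Y b
      ≡⟨ ∑-product X Y ⟩
    ∣ X ∣ₘ * ∣ Y ∣ₘ ∎
    where
    open ≡-Reasoning
    once : ∀ x c → ∑[ n < m ] x * ⟦ c ≟ n ⟧ ≡ x
    once x c = trans (sym (*-distribˡ-sum x (λ n → ⟦ c ≟ n ⟧)))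
                     (trans (cong (x *_) (∑-point c)) (*-identityʳ x))

square-injective : ∀ x y → x * x ≡ y * y → x ≡ y
square-injective x y eq with <-cmp x y
... | tri< x<y _ _ = contradiction eq (<⇒≢ (*-mono-< x<y x<y))
... | tri≈ _ x≡y _ = x≡y
... | tri> _ _ y<x = contradiction (sym eq) (<⇒≢ (*-mono-< y<x y<x))

module KeyIdentity (k : ℕ) (X Y Z : Fin (suc k) → ℕ)
                   (cover : ∀ a → X a + Y a ≡ 1 + Z a) where

  open Residues k using (m)
  open Convolution k

  split : ∀ W n → (W ⋆ X) n + (W ⋆ Y) n ≡ ∣ W ∣ₘ + (W ⋆ Z) n
  split W n = begin
    (W ⋆ X) n + (W ⋆ Y) n                    ≡⟨ sym (⋆-distribʳ W X Y n) ⟩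
    (W ⋆ (λ b → X b + Y b)) n                ≡⟨ ⋆-congʳ W cover n ⟩
    (W ⋆ (λ b → 1 + Z b)) n                  ≡⟨ ⋆-distribʳ W (λ _ → 1) Z n ⟩
    (W ⋆ (λ _ → 1)) n + (W ⋆ Z) n            ≡⟨ cong (_+ (W ⋆ Z) n) (⋆-oneʳ W n) ⟩
    ∣ W ∣ₘ + (W ⋆ Z) n                       ∎
    where open ≡-Reasoning

  module _ (same-reps : ∀ n → (X ⋆ X) n ≡ (Y ⋆ Y) n) where

    same-size : ∣ X ∣ₘ ≡ ∣ Y ∣ₘ
    same-size = square-injective ∣ X ∣ₘ ∣ Y ∣ₘ
      (trans (sym (⋆-total X X)) (trans (sum-cong-≗ same-reps) (⋆-total Y Y)))

    same-cross : ∀ n → (X ⋆ Z) n ≡ (Y ⋆ Z) n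
    same-cross n = +-cancelˡ-≡ ∣ X ∣ₘ ((X ⋆ Z) n) ((Y ⋆ Z) n) (begin
      ∣ X ∣ₘ + (X ⋆ Z) n        ≡⟨ sym (split X n) ⟩
      (X ⋆ X) n + (X ⋆ Y) n     ≡⟨ cong₂ _+_ (same-reps n) (⋆-comm X Y n) ⟩
      (Y ⋆ Y) n + (Y ⋆ X) n     ≡⟨ +-comm ((Y ⋆ Y) n) ((Y ⋆ X) n) ⟩
      (Y ⋆ X) n + (Y ⋆ Y) n     ≡⟨ split Y n ⟩
      ∣ Y ∣ₘ + (Y ⋆ Z) n        ≡⟨ cong (_+ (Y ⋆ Z) n) (sym same-size) ⟩
      ∣ X ∣ₘ + (Y ⋆ Z) n        ∎)
      where open ≡-Reasoning

    key-identity : ∀ n → 2 * (X ⋆ Z) n ≡ ∣ Z ∣ₘ + (Z ⋆ Z) n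
    key-identity n = begin
      2 * (X ⋆ Z) n             ≡⟨ cong (_+_ ((X ⋆ Z) n)) (+-identityʳ _) ⟩
      (X ⋆ Z) n + (X ⋆ Z) n     ≡⟨ cong (_+_ ((X ⋆ Z) n)) (same-cross n) ⟩
      (X ⋆ Z) n + (Y ⋆ Z) n     ≡⟨ cong₂ _+_ (⋆-comm X Z n) (⋆-comm Y Z n) ⟩
      (Z ⋆ X) n + (Z ⋆ Y) n     ≡⟨ split Z n ⟩
      ∣ Z ∣ₘ + (Z ⋆ Z) n        ∎
      where open ≡-Reasoning

𝟙 : ∀ {n} → Subset n → Fin n → ℕ
𝟙 S a = ⟦ a ∈? S ⟧

module Indicators (k : ℕ) where

  open Residues k
  open Convolution k

  R-⋆ : ∀ S n → R S n ≡ (𝟙 S ⋆ 𝟙 S) n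
  R-⋆ S n = count-pairs _ (λ a b → 𝟙 S a * 𝟙 S b * ⟦ a ⊕ b ≟ n ⟧) pair-bracket
    where
    pair-bracket : ∀ a b → ⟦ (a ∈? S) ×-dec ((b ∈? S) ×-dec (a ⊕ b ≟ n)) ⟧ ≡
                           𝟙 S a * 𝟙 S b * ⟦ a ⊕ b ≟ n ⟧
    pair-bracket a b = begin
      ⟦ (a ∈? S) ×-dec ((b ∈? S) ×-dec (a ⊕ b ≟ n)) ⟧
        ≡⟨ ⟦⟧-× (a ∈? S) ((b ∈? S) ×-dec (a ⊕ b ≟ n)) ⟩
      𝟙 S a * ⟦ (b ∈? S) ×-dec (a ⊕ b ≟ n) ⟧
        ≡⟨ cong (𝟙 S a *_) (⟦⟧-× (b ∈? S) (a ⊕ b ≟ n)) ⟩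
      𝟙 S a * (𝟙 S b * ⟦ a ⊕ b ≟ n ⟧)
        ≡⟨ sym (*-assoc (𝟙 S a) (𝟙 S b) ⟦ a ⊕ b ≟ n ⟧) ⟩
      𝟙 S a * 𝟙 S b * ⟦ a ⊕ b ≟ n ⟧ ∎
      where open ≡-Reasoning

  χ-𝟙 : ∀ A x → χ A x ≡ 𝟙 A (res k x)
  χ-𝟙 A x with res k x ∈? A
  ... | yes _ = refl
  ... | no _ = refl

  𝟙-cover : ∀ {A B : Subset m} → A ∪ B ≡ ⊤ → ∀ a → 𝟙 A a + 𝟙 B a ≡ 1 + 𝟙 (A ∩ B) a
  𝟙-cover {A} {B} A∪B≡⊤ a = ⟦⟧-cover (a ∈? A) (a ∈? B) (a ∈? A ∩ B)
    (x∈p∪q⁻ A B (subst (a ∈_) (sym A∪B≡⊤) ∈⊤)) (mk⇔ x∈p∩q⁺ (x∈p∩q⁻ A B))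

  module _ {j} (r : Fin j → ℤ) where

    ∈-resSet : ∀ b → b ∈ resSet k r ⇔ ∃ λ i → b ≡ res k (r i)
    ∈-resSet b = mk⇔
      (λ b∈ → witness (any? (λ i → b ≟ res k (r i)))
                (trans (sym (lookup∘tabulate membership b)) ([]=⇒lookup b∈)))
      (λ found → lookup⇒[]= b (resSet k r)
                   (trans (lookup∘tabulate membership b) (dec-true (any? (λ i → b ≟ res k (r i))) found)))
      where
      membership : Fin m → Bool
      membership x = does (any? (λ i → x ≟ res k (r i)))
      witness : ∀ {p} {P : Set p} (P? : Dec P) → does P? ≡ true → P
      witness (yes p) _ = p

    module _ (inj : Injective _≡_ _≡_ (λ i → res k (r i))) where

      ∑-resSet : (f : Fin m → ℕ) → ∑[ b < m ] 𝟙 (resSet k r) b * f b ≡ ∑[ i < j ] f (res k (r i))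
      ∑-resSet f = trans
        (sum-cong-≗ λ b → cong (_* f b)
          (⟦⟧-⇔ (b ∈? resSet k r) (any? (λ i → b ≟ res k (r i))) (∈-resSet b)))
        (∑-image (λ i → res k (r i)) inj f)

      resSet-size : ∣ 𝟙 (resSet k r) ∣ₘ ≡ j
      resSet-size = trans (sum-cong-≗ λ b → sym (*-identityʳ (𝟙 (resSet k r) b)))
                          (trans (∑-resSet (λ _ → 1)) (∑-one j))

      ⋆-resSet : ∀ X n → (X ⋆ 𝟙 (resSet k r)) (res k n) ≡ ∑[ i < j ] X (res k (n - r i))
      ⋆-resSet X n = begin
        (X ⋆ 𝟙 (resSet k r)) (res k n)
          ≡⟨ ⋆-single X (𝟙 (resSet k r)) (res k n) ⟩
        ∑[ b < m ] X (res k n ⊖ₘ b) * 𝟙 (resSet k r) b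
          ≡⟨ sum-cong-≗ (λ b → *-comm (X (res k n ⊖ₘ b)) (𝟙 (resSet k r) b)) ⟩
        ∑[ b < m ] 𝟙 (resSet k r) b * X (res k n ⊖ₘ b)
          ≡⟨ ∑-resSet (λ b → X (res k n ⊖ₘ b)) ⟩
        ∑[ i < j ] X (res k n ⊖ₘ res k (r i))
          ≡⟨ sum-cong-≗ (λ i → cong X (sym (res-minus n (r i)))) ⟩
        ∑[ i < j ] X (res k (n - r i)) ∎
        where open ≡-Reasoning

lemma2p2 : (k t h : ℕ) → suc k ≡ 2 * h → 0 < t → t < h →
    (A B : Subset (suc k)) → (r : Fin (2 * t) → ℤ) →
    Injective _≡_ _≡_ (λ i → res k (r i)) →
    A ∪ B ≡ ⊤ →
    A ∩ B ≡ resSet k r →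
    (∀ n → R A n ≡ R B n) →
    ∀ (n : ℤ) →
    2 * sum (map (λ i → χ A (n - r i)) (allFin (2 * t)))
    ≡ 2 * t + R (resSet k r) (res k n)
lemma2p2 k t _ _ _ _ A B r inj A∪B≡⊤ A∩B≡C R-equal n = begin
  2 * sum (map (λ i → χ A (n - r i)) (allFin (2 * t)))
    ≡⟨ cong (2 *_) (∑-allFin (2 * t) _) ⟩
  2 * (∑[ i < 2 * t ] χ A (n - r i))
    ≡⟨ cong (2 *_) (trans (sum-cong-≗ λ i → χ-𝟙 A (n - r i)) (sym (⋆-resSet r inj (𝟙 A) n))) ⟩
  2 * (𝟙 A ⋆ Z) (res k n)
    ≡⟨ key-identity same-reps (res k n) ⟩
  ∣ Z ∣ₘ + (Z ⋆ Z) (res k n)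
    ≡⟨ cong₂ _+_ (resSet-size r inj) (sym (R-⋆ C (res k n))) ⟩
  2 * t + R C (res k n) ∎
  where
  open ≡-Reasoning
  open Convolution k
  open Indicators k
  C = resSet k r
  Z = 𝟙 C
  cover : ∀ a → 𝟙 A a + 𝟙 B a ≡ 1 + Z a
  cover a = trans (𝟙-cover A∪B≡⊤ a) (cong (λ S → 1 + 𝟙 S a) A∩B≡C)
  same-reps : ∀ x → (𝟙 A ⋆ 𝟙 A) x ≡ (𝟙 B ⋆ 𝟙 B) x
  same-reps x = trans (sym (R-⋆ A x)) (trans (R-equal x) (R-⋆ B x))
  open KeyIdentity k (𝟙 A) (𝟙 B) Z cover
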